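{- Suppose $$\begin{bmatrix}a_1&b_1\\ c_1&d_1\end{bmatrix}\begin{bmatrix}a_2&b_2\\ c_2&d_2\end{bmatrix}=\begin{bmatrix}a_3&b_3\\ c_3&d_3\end{bmatrix}$$ where $a_i,b_i,c_i,d_i\in\mathbb{Z}$ for $i=1,2,3$, $c_1,d_1,b_2,d_2$ are nonzero, and all three matrices have determinant $1$. Suppose $|d_1|\ge|c_1|$, $|b_1|\ge|a_1|$, $|d_2|\ge|b_2|$, $|c_2|\ge|a_2|$. (1) If $r_1,r_2,r_3,r_4\in\mathbb{Z}$ satisfy $\frac{r_1}{r_2}\le \frac{|a_1|}{|c_1|},\frac{|b_1|}{|d_1|}\le\frac{r_3}{r_4}$ with $|d_1|>r_2$ and $|d_1|>r_4$, then $\frac{r_1}{r_2}\le \frac{|a_3|}{|c_3|},\frac{|b_3|}{|d_3|}\le\frac{r_3}{r_4}$. (2) If $r_5,r_6,r_7,r_8\in\mathbb{Z}\setminus\{0\}$ satisfy $\frac{r_5}{r_6}\le \frac{|a_2|}{|b_2|},\frac{|c_2|}{|d_2|}\le\frac{r_7}{r_8}$ with $|d_2|>r_6$ and $|d_2|>r_8$, then $\frac{r_5}{r_6}\le \frac{|a_3|}{|b_3|},\frac{|c_3|}{|d_3|}\le\frac{r_7}{r_8}$.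
   Context: An inequality of the form $x\le u,v\le y$ means that both $u$ and $v$ lie in the interval $[x,y]$.
   Formalization: The denominators r₂, r₄ in part (1) and r₆, r₈ in part (2) are positive integers, not arbitrary (respectively nonzero) integers. The statement above fails without it. -}

module Defs where

open import Data.Nat using (ℕ; suc)
open import Data.Integer using (ℤ; +_; -[1+_]; -_; _+_; _*_; _-_; ∣_∣)
open import Data.Rational using (ℚ; _/_; 0ℚ)

record M₂ : Set where
  constructor [_,_,_,_]
  field
    a b c d : ℤ

open M₂ public

_⊗_ : M₂ → M₂ → M₂
[ a₁ , b₁ , c₁ , d₁ ] ⊗ [ a₂ , b₂ , c₂ , d₂ ] =
  [ a₁ * a₂ + b₁ * c₂ , a₁ * b₂ + b₁ * d₂ , c₁ * a₂ + d₁ * c₂ , c₁ * b₂ + d₁ * d₂ ]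

det : M₂ → ℤ
det [ a , b , c , d ] = a * d - b * c

-- the rational number p / q for integers p, q with q ≠ 0
-- (q = 0 gets the junk value 0; it is only ever used with q ≠ 0)
_÷ℤ_ : ℤ → ℤ → ℚ
p ÷ℤ (+ 0)      = 0ℚ
p ÷ℤ (+ suc n)  = p / suc n
p ÷ℤ -[1+ n ]   = (- p) / suc n

∣_∣÷∣_∣ : ℤ → ℤ → ℚ
∣ x ∣÷∣ y ∣ = (+ ∣ x ∣) ÷ℤ (+ ∣ y ∣)

{-# OPTIONS --safe #-}
-- Write A, B, C, D, S, T for |a|, |b|, |c|, |d|, |x|, |y|.  Negating a row or column of
-- [ a b ; c d ] together with the matching entry of (x, y) changes none of the absolute values
-- involved, so one may assume b, c, d, y ≥ 0, and then a ≥ 0 is forced by the determinant.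
-- The image of (x, y) then has absolute values S (A, C) + T (B, D) or
-- (T - S) (B, D) + S (B - A, D - C), using |x| ≤ |y|.  A bound r/q ≤ U/V or U/V ≤ r/q is a
-- linear inequality in (U, V); it holds at (A, C) and (B, D) by hypothesis, hence at their
-- nonnegative combinations, and also at (B - A, D - C) because AD - BC = ±1 and q < D.
-- Part (2) is part (1) for the transposed product.
module Submission where

open import Defs
open import Data.Nat using () renaming (_≥_ to _≥ℕ_)
open import Data.Integer using (ℤ; +_; ∣_∣; _<_)
open import Data.Rational using (ℚ) renaming (_≤_ to _≤ℚ_)
open import Data.Product using (_×_)
open import Relation.Binary.PropositionalEquality using (_≡_; _≢_)

open import Data.Nat as ℕ using (ℕ; zero; suc; z≤n)
import Data.Nat.Properties as ℕₚ
open import Data.Integer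
  using (0ℤ; 1ℤ; -1ℤ; +0; +[1+_]; -[1+_]; -_; _+_; _*_; _-_; _≤_; +≤+; +<+; -<-; nonNegative)
open import Data.Integer.Properties
open import Data.Integer.Tactic.RingSolver using (solve-∀)
open import Data.Rational using (_/_; toℚᵘ)
import Data.Rational.Properties as ℚₚ
import Data.Rational.Unnormalised as ℚᵘ
import Data.Rational.Unnormalised.Properties as ℚᵘₚ
open import Data.Product using (_,_)
open import Data.Sum using ([_,_]′)
open import Function using (_∘_; id)
open import Function.Bundles using (_⇔_; mk⇔; module Equivalence)
open import Function.Properties.Equivalence using () renaming (trans to ⇔-trans)
open import Relation.Binary.PropositionalEquality
  using (refl; sym; trans; cong; cong₂; subst; subst₂; module ≡-Reasoning)
open import Relation.Nullary using (contradiction)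

infix 4 _∈[_,_]

_∈[_,_] : ℚ → ℚ → ℚ → Set
q ∈[ lo , hi ] = lo ≤ℚ q × q ≤ℚ hi

÷ℤ-≤⇔ : ∀ {p q r s} → 0ℤ < q → 0ℤ < s → (p ÷ℤ q ≤ℚ r ÷ℤ s) ⇔ (p * s ≤ r * q)
÷ℤ-≤⇔ {q = +0}       (+<+ ())
÷ℤ-≤⇔ {q = -[1+ _ ]} ()
÷ℤ-≤⇔ {q = +[1+ _ ]} {s = +0}       _ (+<+ ())
÷ℤ-≤⇔ {q = +[1+ _ ]} {s = -[1+ _ ]} _ ()
÷ℤ-≤⇔ {p} {+[1+ k ]} {r} {+[1+ l ]} _ _ = mk⇔ to from
  where
  toℚᵘ-/ : ∀ i n → toℚᵘ (i / suc n) ℚᵘ.≃ ℚᵘ.mkℚᵘ i n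
  toℚᵘ-/ i n = ℚₚ.toℚᵘ-fromℚᵘ (ℚᵘ.mkℚᵘ i n)

  to : p / suc k ≤ℚ r / suc l → p * +[1+ l ] ≤ r * +[1+ k ]
  to h with ℚᵘₚ.≤-respʳ-≃ (toℚᵘ-/ r l) (ℚᵘₚ.≤-respˡ-≃ (toℚᵘ-/ p k) (ℚₚ.toℚᵘ-mono-≤ h))
  ... | ℚᵘ.*≤* ps≤rq = ps≤rq

  from : p * +[1+ l ] ≤ r * +[1+ k ] → p / suc k ≤ℚ r / suc l
  from ps≤rq = ℚₚ.toℚᵘ-cancel-≤
    (ℚᵘₚ.≤-respʳ-≃ (ℚᵘₚ.≃-sym (toℚᵘ-/ r l)) (ℚᵘₚ.≤-respˡ-≃ (ℚᵘₚ.≃-sym (toℚᵘ-/ p k)) (ℚᵘ.*≤* ps≤rq)))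

≤⇔0≤ : ∀ {i j k} → j - i ≡ k → (i ≤ j) ⇔ (0ℤ ≤ k)
≤⇔0≤ refl = mk⇔ i≤j⇒0≤j-i 0≤i-j⇒j≤i

lower-bound⇔ : ∀ {p q X Y} → 0ℤ < q → 0ℤ < Y → (p ÷ℤ q ≤ℚ X ÷ℤ Y) ⇔ (0ℤ ≤ q * X + (- p) * Y)
lower-bound⇔ {p} {q} {X} {Y} 0<q 0<Y = ⇔-trans (÷ℤ-≤⇔ 0<q 0<Y) (≤⇔0≤ (identity p q X Y))
  where
  identity : ∀ p q X Y → X * q - p * Y ≡ q * X + (- p) * Y
  identity = solve-∀

upper-bound⇔ : ∀ {p q X Y} → 0ℤ < q → 0ℤ < Y → (X ÷ℤ Y ≤ℚ p ÷ℤ q) ⇔ (0ℤ ≤ (- q) * X + p * Y)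
upper-bound⇔ {p} {q} {X} {Y} 0<q 0<Y = ⇔-trans (÷ℤ-≤⇔ 0<Y 0<q) (≤⇔0≤ (identity p q X Y))
  where
  identity : ∀ p q X Y → p * Y - X * q ≡ (- q) * X + p * Y
  identity = solve-∀

0≤* : ∀ {i j} → 0ℤ ≤ i → 0ℤ ≤ j → 0ℤ ≤ i * j
0≤* {i} 0≤i 0≤j = subst (_≤ i * _) (*-zeroʳ i) (*-monoˡ-≤-nonNeg i {{nonNegative 0≤i}} 0≤j)

-1<⇒0≤ : ∀ {i} → -1ℤ < i → 0ℤ ≤ i
-1<⇒0≤ {+ _}      _        = +≤+ z≤n
-1<⇒0≤ { -[1+ _ ]} (-<- ())

*-unit-< : ∀ {α δ D} → ∣ δ ∣ ≡ 1 → α < D → - α < D → α * δ < D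
*-unit-< {α} {+[1+ 0 ]}  _ α<D _   = subst (_< _) (sym (*-identityʳ α)) α<D
*-unit-< {α} { -[1+ 0 ]} _ _ -α<D = subst (_< _) (trans (sym (-1*i≡-i α)) (*-comm -1ℤ α)) -α<D
*-unit-< {δ = +0} ()
*-unit-< {δ = +[1+ suc _ ]} ()
*-unit-< {δ = -[1+ suc _ ]} ()

aligned-nonneg : ∀ α β A B C D S T →
  0ℤ ≤ α * + A + β * + C → 0ℤ ≤ α * + B + β * + D →
  0ℤ ≤ α * (+ A * + S + + B * + T) + β * (+ C * + S + + D * + T)
aligned-nonneg α β A B C D S T L[A,C] L[B,D] =
  subst (0ℤ ≤_) (identity α β (+ A) (+ B) (+ C) (+ D) (+ S) (+ T))
    (+-mono-≤ (0≤* (nonNegative⁻¹ (+ S)) L[A,C]) (0≤* (nonNegative⁻¹ (+ T)) L[B,D]))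
  where
  identity : ∀ α β A B C D S T →
    S * (α * A + β * C) + T * (α * B + β * D) ≡ α * (A * S + B * T) + β * (C * S + D * T)
  identity = solve-∀

-- D times the form at (B - A, D - C) is (D - C) (α B + β D) - α (AD - BC) > -D, as |α| < D.
difference-nonneg : ∀ α β A B C D → ∣ + A * + D - + B * + C ∣ ≡ 1 → C ℕ.≤ D →
  α < + D → - α < + D → 0ℤ ≤ α * + B + β * + D →
  0ℤ ≤ α * (+ B - + A) + β * (+ D - + C)
difference-nonneg α β A B C D unimodular C≤D α<D -α<D L[B,D] =
  -1<⇒0≤ (*-cancelˡ-<-nonNeg (+ D) (begin-strict
    + D * -1ℤ                                          ≡⟨ *-comm (+ D) -1ℤ ⟩
    -1ℤ * + D                                          ≡⟨ -1*i≡-i (+ D) ⟩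
    - + D                                              <⟨ neg-mono-< (*-unit-< unimodular α<D -α<D) ⟩
    - (α * δ)                                          ≤⟨ i≤j+i _ _ {{nonNegative (0≤* D-C≥0 L[B,D])}} ⟩
    (+ D - + C) * (α * + B + β * + D) + - (α * δ)      ≡⟨ identity α β (+ A) (+ B) (+ C) (+ D) ⟩
    + D * (α * (+ B - + A) + β * (+ D - + C))          ∎))
  where
  open ≤-Reasoning
  δ = + A * + D - + B * + C
  D-C≥0 : 0ℤ ≤ + D - + C
  D-C≥0 = i≤j⇒0≤j-i (+≤+ C≤D)
  identity : ∀ α β A B C D →
    (D - C) * (α * B + β * D) + - (α * (A * D - B * C)) ≡ D * (α * (B - A) + β * (D - C))
  identity = solve-∀

opposed-nonneg : ∀ α β A B C D S T → S ℕ.≤ T →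
  0ℤ ≤ α * + B + β * + D → 0ℤ ≤ α * (+ B - + A) + β * (+ D - + C) →
  0ℤ ≤ α * (+ B * + T - + A * + S) + β * (+ D * + T - + C * + S)
opposed-nonneg α β A B C D S T S≤T L[B,D] L[B-A,D-C] =
  subst (0ℤ ≤_) (identity α β (+ A) (+ B) (+ C) (+ D) (+ S) (+ T))
    (+-mono-≤ (0≤* (i≤j⇒0≤j-i (+≤+ S≤T)) L[B,D]) (0≤* (nonNegative⁻¹ (+ S)) L[B-A,D-C]))
  where
  identity : ∀ α β A B C D S T →
    (T - S) * (α * B + β * D) + S * (α * (B - A) + β * (D - C)) ≡
    α * (B * T - A * S) + β * (D * T - C * S)
  identity = solve-∀

-- In absolute values, the image (a x + b y, c x + d y) of a column is a sum or a difference of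
-- S (A, C) and T (B, D), according to whether the summands have equal or opposite signs.
data Image (A B C D S T : ℕ) : ℤ → ℤ → Set where
  aligned : Image A B C D S T (+ A * + S + + B * + T) (+ C * + S + + D * + T)
  opposed : Image A B C D S T (+ B * + T - + A * + S) (+ D * + T - + C * + S)

image-nonneg : ∀ α β {A B C D S T U V} → ∣ + A * + D - + B * + C ∣ ≡ 1 → C ℕ.≤ D → S ℕ.≤ T →
  α < + D → - α < + D → 0ℤ ≤ α * + A + β * + C → 0ℤ ≤ α * + B + β * + D →
  Image A B C D S T U V → 0ℤ ≤ α * U + β * V
image-nonneg α β {A} {B} {C} {D} {S} {T} _ _ _ _ _ L[A,C] L[B,D] aligned =
  aligned-nonneg α β A B C D S T L[A,C] L[B,D]
image-nonneg α β {A} {B} {C} {D} {S} {T} unimodular C≤D S≤T α<D -α<D _ L[B,D] opposed =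
  opposed-nonneg α β A B C D S T S≤T L[B,D] (difference-nonneg α β A B C D unimodular C≤D α<D -α<D L[B,D])

AbsoluteForm : (A B C D S T U V : ℕ) → Set
AbsoluteForm A B C D S T U V = ∣ + A * + D - + B * + C ∣ ≡ 1 × Image A B C D S T (+ U) (+ V)

AbsoluteForm-cong : ∀ {A B C D S T U V A′ B′ C′ D′ S′ T′ U′ V′} →
  A ≡ A′ → B ≡ B′ → C ≡ C′ → D ≡ D′ → S ≡ S′ → T ≡ T′ → U ≡ U′ → V ≡ V′ →
  AbsoluteForm A B C D S T U V → AbsoluteForm A′ B′ C′ D′ S′ T′ U′ V′
AbsoluteForm-cong refl refl refl refl refl refl refl refl = id

ColumnForm : (a b c d x y : ℤ) → Set
ColumnForm a b c d x y =
  AbsoluteForm (∣ a ∣) (∣ b ∣) (∣ c ∣) (∣ d ∣) (∣ x ∣) (∣ y ∣) (∣ a * x + b * y ∣) (∣ c * x + d * y ∣)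

ColumnForm-negate-column₁ : ∀ a b c d x y → ColumnForm (- a) b (- c) d (- x) y → ColumnForm a b c d x y
ColumnForm-negate-column₁ a b c d x y = AbsoluteForm-cong
  (∣-i∣≡∣i∣ a) refl (∣-i∣≡∣i∣ c) refl (∣-i∣≡∣i∣ x) refl
  (cong ∣_∣ (identity a b x y)) (cong ∣_∣ (identity c d x y))
  where
  identity : ∀ p q x y → (- p) * (- x) + q * y ≡ p * x + q * y
  identity = solve-∀

ColumnForm-negate-column₂ : ∀ a b c d x y → ColumnForm a (- b) c (- d) x (- y) → ColumnForm a b c d x y
ColumnForm-negate-column₂ a b c d x y = AbsoluteForm-cong
  refl (∣-i∣≡∣i∣ b) refl (∣-i∣≡∣i∣ d) refl (∣-i∣≡∣i∣ y)
  (cong ∣_∣ (identity a b x y)) (cong ∣_∣ (identity c d x y))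
  where
  identity : ∀ p q x y → p * x + (- q) * (- y) ≡ p * x + q * y
  identity = solve-∀

ColumnForm-negate-row₁ : ∀ a b c d x y → ColumnForm (- a) (- b) c d x y → ColumnForm a b c d x y
ColumnForm-negate-row₁ a b c d x y = AbsoluteForm-cong
  (∣-i∣≡∣i∣ a) (∣-i∣≡∣i∣ b) refl refl refl refl
  (trans (cong ∣_∣ (identity a b x y)) (∣-i∣≡∣i∣ (a * x + b * y))) refl
  where
  identity : ∀ p q x y → (- p) * x + (- q) * y ≡ - (p * x + q * y)
  identity = solve-∀

ColumnForm-negate-vector : ∀ a b c d x y → ColumnForm a b c d (- x) (- y) → ColumnForm a b c d x y
ColumnForm-negate-vector a b c d x y = AbsoluteForm-cong
  refl refl refl refl (∣-i∣≡∣i∣ x) (∣-i∣≡∣i∣ y)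
  (trans (cong ∣_∣ (identity a b x y)) (∣-i∣≡∣i∣ (a * x + b * y)))
  (trans (cong ∣_∣ (identity c d x y)) (∣-i∣≡∣i∣ (c * x + d * y)))
  where
  identity : ∀ p q x y → p * (- x) + q * (- y) ≡ - (p * x + q * y)
  identity = solve-∀

det-negate-column₁ : ∀ a b c d → (- a) * d - b * (- c) ≡ - (a * d - b * c)
det-negate-column₁ = solve-∀

det-negate-column₂ : ∀ a b c d → a * (- d) - (- b) * c ≡ - (a * d - b * c)
det-negate-column₂ = solve-∀

det-negate-row₁ : ∀ a b c d → (- a) * d - (- b) * c ≡ - (a * d - b * c)
det-negate-row₁ = solve-∀

unimodular-neg : ∀ {δ δ′} → δ′ ≡ - δ → ∣ δ ∣ ≡ 1 → ∣ δ′ ∣ ≡ 1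
unimodular-neg {δ} δ′≡-δ ∣δ∣≡1 = trans (cong ∣_∣ δ′≡-δ) (trans (∣-i∣≡∣i∣ δ) ∣δ∣≡1)

∣-i∣≤ : ∀ i {n} → ∣ i ∣ ℕ.≤ n → ∣ - i ∣ ℕ.≤ n
∣-i∣≤ i = subst (ℕ._≤ _) (sym (∣-i∣≡∣i∣ i))

≤∣-i∣ : ∀ i {n} → n ℕ.≤ ∣ i ∣ → n ℕ.≤ ∣ - i ∣
≤∣-i∣ i = subst (_ ℕ.≤_) (sym (∣-i∣≡∣i∣ i))

+*+-mono-≤ : ∀ {P Q X Y} → P ℕ.≤ Q → X ℕ.≤ Y → + P * + X ≤ + Q * + Y
+*+-mono-≤ {P} {Q} {X} {Y} P≤Q X≤Y = subst₂ _≤_ (pos-* P X) (pos-* Q Y) (+≤+ (ℕₚ.*-mono-≤ P≤Q X≤Y))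

aligned-abs : ∀ P Q X Y → + ∣ + P * + X + + Q * + Y ∣ ≡ + P * + X + + Q * + Y
aligned-abs P Q X Y = 0≤i⇒+∣i∣≡i
  (+-mono-≤ (0≤* (nonNegative⁻¹ (+ P)) (nonNegative⁻¹ (+ X))) (0≤* (nonNegative⁻¹ (+ Q)) (nonNegative⁻¹ (+ Y))))

opposed-abs : ∀ P Q X Y → P ℕ.≤ Q → X ℕ.≤ Y → + ∣ + P * - + X + + Q * + Y ∣ ≡ + Q * + Y - + P * + X
opposed-abs P Q X Y P≤Q X≤Y =
  trans (cong (+_ ∘ ∣_∣) (identity (+ P) (+ Q) (+ X) (+ Y))) (0≤i⇒+∣i∣≡i (i≤j⇒0≤j-i (+*+-mono-≤ P≤Q X≤Y)))
  where
  identity : ∀ p q x y → p * (- x) + q * y ≡ q * y - p * x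
  identity = solve-∀

columnForm-0≤b,y : ∀ a k n m x j → ∣ a * +[1+ m ] - + k * +[1+ n ] ∣ ≡ 1 →
  ∣ a ∣ ℕ.≤ k → suc n ℕ.≤ suc m → ∣ x ∣ ℕ.≤ j → ColumnForm a (+ k) +[1+ n ] +[1+ m ] x (+ j)
-- For a < 0 we get ad < 0 < bc, so |ad - bc| ≥ 2.
columnForm-0≤b,y -[1+ _ ] zero    _ _ _ _ _  ()
columnForm-0≤b,y -[1+ _ ] (suc _) _ _ _ _ ()
columnForm-0≤b,y (+ i) k n m (+ s) j unimodular _ _ _ = unimodular ,
  subst₂ (Image i k (suc n) (suc m) s j)
    (sym (aligned-abs i k s j)) (sym (aligned-abs (suc n) (suc m) s j)) aligned
columnForm-0≤b,y (+ i) k n m -[1+ s ] j unimodular i≤k n≤m s<j = unimodular ,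
  subst₂ (Image i k (suc n) (suc m) (suc s) j)
    (sym (opposed-abs i k (suc s) j i≤k s<j)) (sym (opposed-abs (suc n) (suc m) (suc s) j n≤m s<j)) opposed

columnForm-0≤y : ∀ a b n m x j → ∣ a * +[1+ m ] - b * +[1+ n ] ∣ ≡ 1 →
  ∣ a ∣ ℕ.≤ ∣ b ∣ → suc n ℕ.≤ suc m → ∣ x ∣ ℕ.≤ j → ColumnForm a b +[1+ n ] +[1+ m ] x (+ j)
columnForm-0≤y a (+ k)    n m x j = columnForm-0≤b,y a k n m x j
columnForm-0≤y a -[1+ k ] n m x j unimodular a≤b n≤m x≤j =
  ColumnForm-negate-row₁ a -[1+ k ] +[1+ n ] +[1+ m ] x (+ j)
    (columnForm-0≤b,y (- a) (suc k) n m x j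
      (unimodular-neg (det-negate-row₁ a -[1+ k ] +[1+ n ] +[1+ m ]) unimodular) (∣-i∣≤ a a≤b) n≤m x≤j)

columnForm-0<c,d : ∀ a b n m x y → ∣ a * +[1+ m ] - b * +[1+ n ] ∣ ≡ 1 →
  ∣ a ∣ ℕ.≤ ∣ b ∣ → suc n ℕ.≤ suc m → ∣ x ∣ ℕ.≤ ∣ y ∣ → ColumnForm a b +[1+ n ] +[1+ m ] x y
columnForm-0<c,d a b n m x (+ j)    = columnForm-0≤y a b n m x j
columnForm-0<c,d a b n m x -[1+ j ] unimodular a≤b n≤m x≤y =
  ColumnForm-negate-vector a b +[1+ n ] +[1+ m ] x -[1+ j ]
    (columnForm-0≤y a b n m (- x) (suc j) unimodular a≤b n≤m (∣-i∣≤ x x≤y))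

columnForm-0<c : ∀ a b n d x y → ∣ a * d - b * +[1+ n ] ∣ ≡ 1 →
  ∣ a ∣ ℕ.≤ ∣ b ∣ → suc n ℕ.≤ ∣ d ∣ → ∣ x ∣ ℕ.≤ ∣ y ∣ → ColumnForm a b +[1+ n ] d x y
columnForm-0<c a b n +0       x y _ _ ()
columnForm-0<c a b n +[1+ m ] x y = columnForm-0<c,d a b n m x y
columnForm-0<c a b n -[1+ m ] x y unimodular a≤b c≤d x≤y =
  ColumnForm-negate-column₂ a b +[1+ n ] -[1+ m ] x y
    (columnForm-0<c,d a (- b) n m x (- y)
      (unimodular-neg (det-negate-column₂ a b +[1+ n ] -[1+ m ]) unimodular) (≤∣-i∣ b a≤b) c≤d (≤∣-i∣ y x≤y))

columnForm : ∀ a b c d x y → c ≢ 0ℤ → ∣ a * d - b * c ∣ ≡ 1 →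
  ∣ a ∣ ℕ.≤ ∣ b ∣ → ∣ c ∣ ℕ.≤ ∣ d ∣ → ∣ x ∣ ℕ.≤ ∣ y ∣ → ColumnForm a b c d x y
columnForm a b +0       d x y c≢0 = contradiction refl c≢0
columnForm a b +[1+ n ] d x y _   = columnForm-0<c a b n d x y
columnForm a b -[1+ n ] d x y _ unimodular a≤b c≤d x≤y =
  ColumnForm-negate-column₁ a b -[1+ n ] d x y
    (columnForm-0<c (- a) b n d (- x) y
      (unimodular-neg (det-negate-column₁ a b -[1+ n ] d) unimodular) (∣-i∣≤ a a≤b) c≤d (∣-i∣≤ x x≤y))

unimodular⇒≢0 : ∀ {δ} → ∣ δ ∣ ≡ 1 → δ ≢ 0ℤ
unimodular⇒≢0 () refl

det≢0⇒kernel-y≡0 : ∀ a b c d x y → a * d - b * c ≢ 0ℤ →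
  a * x + b * y ≡ 0ℤ → c * x + d * y ≡ 0ℤ → y ≡ 0ℤ
det≢0⇒kernel-y≡0 a b c d x y δ≢0 u≡0 v≡0 =
  [ (λ δ≡0 → contradiction δ≡0 δ≢0) , id ]′ (i*j≡0⇒i≡0∨j≡0 (a * d - b * c) δy≡0)
  where
  identity : ∀ a b c d x y → (a * d - b * c) * y ≡ a * (c * x + d * y) - c * (a * x + b * y)
  identity = solve-∀
  δy≡0 : (a * d - b * c) * y ≡ 0ℤ
  δy≡0 = begin
    (a * d - b * c) * y                       ≡⟨ identity a b c d x y ⟩
    a * (c * x + d * y) - c * (a * x + b * y) ≡⟨ cong₂ (λ v u → a * v - c * u) v≡0 u≡0 ⟩
    a * 0ℤ - c * 0ℤ                           ≡⟨ cong₂ _-_ (*-zeroʳ a) (*-zeroʳ c) ⟩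
    0ℤ                                        ∎
    where open ≡-Reasoning

0≤-q*U⇒U≡0 : ∀ {q U} → 0ℤ < q → 0ℤ ≤ (- q) * + U → U ≡ 0
0≤-q*U⇒U≡0 {+0}       (+<+ ())
0≤-q*U⇒U≡0 { -[1+ _ ]} ()
0≤-q*U⇒U≡0 {+[1+ _ ]} {zero}  _ _  = refl
0≤-q*U⇒U≡0 {+[1+ _ ]} {suc _} _ ()

column-ratio-∈ : ∀ a b c d x y → c ≢ 0ℤ → ∣ a * d - b * c ∣ ≡ 1 →
  ∣ a ∣ ℕ.≤ ∣ b ∣ → ∣ c ∣ ℕ.≤ ∣ d ∣ → ∣ x ∣ ℕ.≤ ∣ y ∣ → y ≢ 0ℤ →
  ∀ {p q r s} → 0ℤ < q → 0ℤ < s → q < + ∣ d ∣ → s < + ∣ d ∣ →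
  ∣ a ∣÷∣ c ∣ ∈[ p ÷ℤ q , r ÷ℤ s ] → ∣ b ∣÷∣ d ∣ ∈[ p ÷ℤ q , r ÷ℤ s ] →
  ∣ a * x + b * y ∣÷∣ c * x + d * y ∣ ∈[ p ÷ℤ q , r ÷ℤ s ]
column-ratio-∈ a b c d x y c≢0 unimodular a≤b c≤d x≤y y≢0 {p} {q} {r} {s}
               0<q 0<s q<D s<D (p≤a/c , a/c≤r) (p≤b/d , b/d≤r) =
  from (lower-bound⇔ 0<q 0<V) lower , from (upper-bound⇔ 0<s 0<V) upper
  where
  open Equivalence using (to; from)
  u = a * x + b * y
  v = c * x + d * y

  0<C : 0ℤ < + ∣ c ∣
  0<C = +<+ (ℕₚ.n≢0⇒n>0 (c≢0 ∘ ∣i∣≡0⇒i≡0))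
  0<D : 0ℤ < + ∣ d ∣
  0<D = <-≤-trans 0<C (+≤+ c≤d)
  -<D : ∀ {t} → 0ℤ < t → - t < + ∣ d ∣
  -<D 0<t = <-trans (neg-mono-< 0<t) 0<D

  form-at-image : ∀ α β → α < + ∣ d ∣ → - α < + ∣ d ∣ →
    0ℤ ≤ α * + ∣ a ∣ + β * + ∣ c ∣ → 0ℤ ≤ α * + ∣ b ∣ + β * + ∣ d ∣ →
    0ℤ ≤ α * + ∣ u ∣ + β * + ∣ v ∣
  form-at-image α β α<D -α<D L[A,C] L[B,D] with columnForm a b c d x y c≢0 unimodular a≤b c≤d x≤y
  ... | unimodular′ , image = image-nonneg α β unimodular′ c≤d x≤y α<D -α<D L[A,C] L[B,D] image

  lower : 0ℤ ≤ q * + ∣ u ∣ + (- p) * + ∣ v ∣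
  lower = form-at-image q (- p) q<D (-<D 0<q)
    (to (lower-bound⇔ 0<q 0<C) p≤a/c) (to (lower-bound⇔ 0<q 0<D) p≤b/d)
  upper : 0ℤ ≤ (- s) * + ∣ u ∣ + r * + ∣ v ∣
  upper = form-at-image (- s) r (-<D 0<s) (subst (_< _) (sym (neg-involutive s)) s<D)
    (to (upper-bound⇔ 0<s 0<C) a/c≤r) (to (upper-bound⇔ 0<s 0<D) b/d≤r)

  -- If v = 0 the upper bound forces u = 0, so (x, y) is in the kernel of an invertible matrix.
  V≢0 : ∣ v ∣ ≢ 0
  V≢0 V≡0 = y≢0 (det≢0⇒kernel-y≡0 a b c d x y (unimodular⇒≢0 unimodular) (∣i∣≡0⇒i≡0 U≡0) (∣i∣≡0⇒i≡0 V≡0))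
    where
    upper-at-V≡0 : 0ℤ ≤ (- s) * + ∣ u ∣
    upper-at-V≡0 = subst (0ℤ ≤_) (trans (cong (λ t → (- s) * + ∣ u ∣ + t) (*-zeroʳ r)) (+-identityʳ _))
      (subst (λ V → 0ℤ ≤ (- s) * + ∣ u ∣ + r * + V) V≡0 upper)
    U≡0 : ∣ u ∣ ≡ 0
    U≡0 = 0≤-q*U⇒U≡0 0<s upper-at-V≡0
  0<V : 0ℤ < + ∣ v ∣
  0<V = +<+ (ℕₚ.n≢0⇒n>0 V≢0)

row-ratio-∈ : ∀ a b c d x y → b ≢ 0ℤ → ∣ a * d - b * c ∣ ≡ 1 →
  ∣ a ∣ ℕ.≤ ∣ c ∣ → ∣ b ∣ ℕ.≤ ∣ d ∣ → ∣ x ∣ ℕ.≤ ∣ y ∣ → y ≢ 0ℤ →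
  ∀ {p q r s} → 0ℤ < q → 0ℤ < s → q < + ∣ d ∣ → s < + ∣ d ∣ →
  ∣ a ∣÷∣ b ∣ ∈[ p ÷ℤ q , r ÷ℤ s ] → ∣ c ∣÷∣ d ∣ ∈[ p ÷ℤ q , r ÷ℤ s ] →
  ∣ x * a + y * c ∣÷∣ x * b + y * d ∣ ∈[ p ÷ℤ q , r ÷ℤ s ]
row-ratio-∈ a b c d x y b≢0 unimodular a≤c b≤d x≤y y≢0 {p} {q} {r} {s} 0<q 0<s q<D s<D a/b∈ c/d∈ =
  subst₂ (λ u v → ∣ u ∣÷∣ v ∣ ∈[ p ÷ℤ q , r ÷ℤ s ])
    (cong₂ _+_ (*-comm a x) (*-comm c y)) (cong₂ _+_ (*-comm b x) (*-comm d y))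
    (column-ratio-∈ a c b d x y b≢0 (trans (cong (λ t → ∣ a * d - t ∣) (*-comm c b)) unimodular)
      a≤c b≤d x≤y y≢0 0<q 0<s q<D s<D a/b∈ c/d∈)

column-nonzero : ∀ a b c d → a * d - b * c ≡ 1ℤ → ∣ a ∣ ℕ.≤ ∣ c ∣ → c ≢ 0ℤ
column-nonzero +[1+ _ ] _ _ _ _   () refl
column-nonzero -[1+ _ ] _ _ _ _   () refl
column-nonzero +0       b _ _ det _  refl = contradiction (trans (sym det) (cong (λ t → 0ℤ - t) (*-zeroʳ b))) λ ()

row-nonzero : ∀ a b c d → a * d - b * c ≡ 1ℤ → ∣ a ∣ ℕ.≤ ∣ b ∣ → b ≢ 0ℤ
row-nonzero a b c d det = column-nonzero a c b d (trans (cong (λ t → a * d - t) (*-comm c b)) det)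

lemma2p1 : (M₁ M₂′ M₃ : M₂) →
  M₁ ⊗ M₂′ ≡ M₃ →
  c M₁ ≢ + 0 → d M₁ ≢ + 0 → b M₂′ ≢ + 0 → d M₂′ ≢ + 0 →
  det M₁ ≡ + 1 → det M₂′ ≡ + 1 → det M₃ ≡ + 1 →
  ∣ d M₁ ∣ ≥ℕ ∣ c M₁ ∣ → ∣ b M₁ ∣ ≥ℕ ∣ a M₁ ∣ →
  ∣ d M₂′ ∣ ≥ℕ ∣ b M₂′ ∣ → ∣ c M₂′ ∣ ≥ℕ ∣ a M₂′ ∣ →
  -- part (1)
  ((r₁ r₂ r₃ r₄ : ℤ) → + 0 < r₂ → + 0 < r₄ →
    (r₁ ÷ℤ r₂) ≤ℚ ∣ a M₁ ∣÷∣ c M₁ ∣ → ∣ a M₁ ∣÷∣ c M₁ ∣ ≤ℚ (r₃ ÷ℤ r₄) →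
    (r₁ ÷ℤ r₂) ≤ℚ ∣ b M₁ ∣÷∣ d M₁ ∣ → ∣ b M₁ ∣÷∣ d M₁ ∣ ≤ℚ (r₃ ÷ℤ r₄) →
    r₂ < + ∣ d M₁ ∣ → r₄ < + ∣ d M₁ ∣ →
    ((r₁ ÷ℤ r₂) ≤ℚ ∣ a M₃ ∣÷∣ c M₃ ∣ × ∣ a M₃ ∣÷∣ c M₃ ∣ ≤ℚ (r₃ ÷ℤ r₄)) ×
    ((r₁ ÷ℤ r₂) ≤ℚ ∣ b M₃ ∣÷∣ d M₃ ∣ × ∣ b M₃ ∣÷∣ d M₃ ∣ ≤ℚ (r₃ ÷ℤ r₄)))
  ×
  -- part (2)
  ((r₅ r₆ r₇ r₈ : ℤ) → r₅ ≢ + 0 → r₇ ≢ + 0 → + 0 < r₆ → + 0 < r₈ →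
    (r₅ ÷ℤ r₆) ≤ℚ ∣ a M₂′ ∣÷∣ b M₂′ ∣ → ∣ a M₂′ ∣÷∣ b M₂′ ∣ ≤ℚ (r₇ ÷ℤ r₈) →
    (r₅ ÷ℤ r₆) ≤ℚ ∣ c M₂′ ∣÷∣ d M₂′ ∣ → ∣ c M₂′ ∣÷∣ d M₂′ ∣ ≤ℚ (r₇ ÷ℤ r₈) →
    r₆ < + ∣ d M₂′ ∣ → r₈ < + ∣ d M₂′ ∣ →
    ((r₅ ÷ℤ r₆) ≤ℚ ∣ a M₃ ∣÷∣ b M₃ ∣ × ∣ a M₃ ∣÷∣ b M₃ ∣ ≤ℚ (r₇ ÷ℤ r₈)) ×
    ((r₅ ÷ℤ r₆) ≤ℚ ∣ c M₃ ∣÷∣ d M₃ ∣ × ∣ c M₃ ∣÷∣ d M₃ ∣ ≤ℚ (r₇ ÷ℤ r₈)))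
lemma2p1 [ a₁ , b₁ , c₁ , d₁ ] [ a₂ , b₂ , c₂ , d₂ ] _ refl c₁≢0 d₁≢0 b₂≢0 d₂≢0 det₁ det₂ _
         c₁≤d₁ a₁≤b₁ b₂≤d₂ a₂≤c₂ =
  (λ r₁ r₂ r₃ r₄ 0<r₂ 0<r₄ h₁ h₂ h₃ h₄ r₂<d₁ r₄<d₁ →
    column-ratio-∈ a₁ b₁ c₁ d₁ a₂ c₂ c₁≢0 (cong ∣_∣ det₁) a₁≤b₁ c₁≤d₁ a₂≤c₂ c₂≢0
      0<r₂ 0<r₄ r₂<d₁ r₄<d₁ (h₁ , h₂) (h₃ , h₄) ,
    column-ratio-∈ a₁ b₁ c₁ d₁ b₂ d₂ c₁≢0 (cong ∣_∣ det₁) a₁≤b₁ c₁≤d₁ b₂≤d₂ d₂≢0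
      0<r₂ 0<r₄ r₂<d₁ r₄<d₁ (h₁ , h₂) (h₃ , h₄)) ,
  (λ r₅ r₆ r₇ r₈ _ _ 0<r₆ 0<r₈ h₁ h₂ h₃ h₄ r₆<d₂ r₈<d₂ →
    row-ratio-∈ a₂ b₂ c₂ d₂ a₁ b₁ b₂≢0 (cong ∣_∣ det₂) a₂≤c₂ b₂≤d₂ a₁≤b₁ b₁≢0
      0<r₆ 0<r₈ r₆<d₂ r₈<d₂ (h₁ , h₂) (h₃ , h₄) ,
    row-ratio-∈ a₂ b₂ c₂ d₂ c₁ d₁ b₂≢0 (cong ∣_∣ det₂) a₂≤c₂ b₂≤d₂ c₁≤d₁ d₁≢0
      0<r₆ 0<r₈ r₆<d₂ r₈<d₂ (h₁ , h₂) (h₃ , h₄))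
  where
  c₂≢0 : c₂ ≢ 0ℤ
  c₂≢0 = column-nonzero a₂ b₂ c₂ d₂ det₂ a₂≤c₂
  b₁≢0 : b₁ ≢ 0ℤ
  b₁≢0 = row-nonzero a₁ b₁ c₁ d₁ det₁ a₁≤b₁
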